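{- If $n$ is a positive odd integer and $r$ and $s$ are any integers, then \[ \sum_{k = 0}^n \binom{2n}{2k}F_{3k + r} F_{3k + s} = 2^{2n - 1}F_n F_{3n + r + s}. \]
   Context: The Fibonacci numbers $F_j$ and Lucas numbers $L_j$ are defined for all integers $j$ by $F_0=0$, $F_1=1$, $L_0=2$, $L_1=1$, $F_j=F_{j-1}+F_{j-2}$, $L_j=L_{j-1}+L_{j-2}$, with $F_{ -j}=(-1)^{j-1}F_j$ and $L_{ -j}=(-1)^jL_j$. -}

module Defs where

open import Data.Nat as ℕ using (ℕ; zero; suc)
open import Data.Integer as ℤ using (ℤ; +_; -[1+_]; _+_; _*_; -_)

fibℕ : ℕ → ℕ
fibℕ zero = zero
fibℕ (suc zero) = suc zero
fibℕ (suc (suc n)) = fibℕ (suc n) ℕ.+ fibℕ n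

-- Fibonacci numbers on ℤ, extended by F_{-j} = (-1)^{j-1} F_j
fib : ℤ → ℤ
fib (+ n) = + fibℕ n
fib -[1+ n ] with n ℕ.% 2
... | zero = + fibℕ (suc n)          -- j = n+1 odd: (-1)^{j-1} = 1
... | suc _ = - (+ fibℕ (suc n))     -- j = n+1 even: (-1)^{j-1} = -1

sumTo : ℕ → (ℕ → ℤ) → ℤ
sumTo zero f = f zero
sumTo (suc n) f = sumTo n f + f (suc n)

module Submission where

-- Work in ℤ[φ], φ² = φ + 1, with conjugate ψ = 1 - φ. There φ^z = F_{z-1} + F_z φ for every integer z,
-- and F_z (φ - ψ) = φ^z - ψ^z with (φ - ψ)² = 5. Expanding 5 F_{3k+r} F_{3k+s} this way writes five
-- times the sum as T + ψ-conjugate of T, where T = φ^{r+s} Σ C(2n,2k) φ^{6k}, minus a cross term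
-- (φ^r ψ^s + ψ^r φ^s) Σ C(2n,2k) (-1)^k which vanishes for odd n under k ↦ n - k. Finally
-- 2 Σ C(2n,2k) x^{2k} = (1+x)^{2n} + (1-x)^{2n}, and 1 + φ³ = 2φ², 1 - φ³ = -2φ give, for odd n,
-- 2T = 4^n φ^{3n+r+s} (φ^n - ψ^n); conjugating and adding yields 10 · sum = 5 · 4^n F_n F_{3n+r+s}.

open import Algebra.Bundles using (CommutativeRing)
open import Algebra.Structures using (IsCommutativeRing)
open import Data.Integer as ℤ using (ℤ; +_; -[1+_]; 0ℤ; 1ℤ; -1ℤ)
import Data.Integer.Properties as ℤₚ
open import Data.Integer.Tactic.RingSolver using (solve-∀)
open import Data.Maybe using (Maybe; just; nothing)
open import Data.Nat as ℕ using (ℕ; zero; suc)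
import Data.Nat.Properties as ℕₚ
open import Data.Product using (_×_; _,_; proj₁; proj₂)
open import Function using (_∘_)
open import Level using (0ℓ)
open import Relation.Binary.PropositionalEquality
import Tactic.RingSolver as Solver
import Tactic.RingSolver.Core.AlmostCommutativeRing as ACR

open import Defs

module FibonacciRecurrence where
  open import Data.Integer using (_+_; _*_; -_; _^_)

  private
    -- (-1)^m, computed by the same case split on m % 2 as `fib` on negative arguments.
    parity : ℕ → ℤ
    parity m with m ℕ.% 2
    ... | zero = 1ℤ
    ... | suc _ = -1ℤ

    fib-negative-parity : ∀ m → fib -[1+ m ] ≡ parity m * + fibℕ (suc m)
    fib-negative-parity m with m ℕ.% 2
    ... | zero = sym (ℤₚ.*-identityˡ _)
    ... | suc _ = sym (ℤₚ.-1*i≡-i _)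

    parity≡-1^ : ∀ m → parity m ≡ -1ℤ ^ m
    parity≡-1^ zero = refl
    parity≡-1^ (suc zero) = refl
    parity≡-1^ (suc (suc m)) = trans (parity≡-1^ m) (double-negation (-1ℤ ^ m))
      where
      double-negation : ∀ σ → σ ≡ -1ℤ * (-1ℤ * σ)
      double-negation = solve-∀

  fib-negative : ∀ m → fib -[1+ m ] ≡ -1ℤ ^ m * + fibℕ (suc m)
  fib-negative m = trans (fib-negative-parity m) (cong (_* + fibℕ (suc m)) (parity≡-1^ m))

  -1^odd : ∀ n → n ℕ.% 2 ≡ 1 → -1ℤ ^ n ≡ -1ℤ
  -1^odd n odd = trans (sym (parity≡-1^ n)) (parity-odd n odd)
    where
    parity-odd : ∀ n → n ℕ.% 2 ≡ 1 → parity n ≡ -1ℤ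
    parity-odd n odd with n ℕ.% 2
    parity-odd n refl | .1 = refl

  fib-rec : ∀ z → fib (ℤ.suc (ℤ.suc z)) ≡ fib (ℤ.suc z) + fib z
  fib-rec (+ n) = refl
  fib-rec -[1+ zero ] = refl
  fib-rec -[1+ suc zero ] = refl
  fib-rec -[1+ suc (suc m) ] = begin
    fib -[1+ m ]                                       ≡⟨ fib-negative m ⟩
    -1ℤ ^ m * + fibℕ (suc m)                           ≡⟨ three-term (-1ℤ ^ m) _ _ ⟩
    -1ℤ ^ suc m * + fibℕ (2 ℕ.+ m) + -1ℤ ^ (2 ℕ.+ m) * + fibℕ (3 ℕ.+ m)
      ≡⟨ sym (cong₂ _+_ (fib-negative (suc m)) (fib-negative (suc (suc m)))) ⟩
    fib -[1+ suc m ] + fib -[1+ suc (suc m) ]          ∎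
    where
    open ≡-Reasoning
    three-term : ∀ σ a b → σ * a ≡ -1ℤ * σ * b + -1ℤ * (-1ℤ * σ) * (b + a)
    three-term = solve-∀

-- (a , b) stands for a + bφ, where φ² = φ + 1.
module GoldenIntegers where
  ℤ[φ] : Set
  ℤ[φ] = ℤ × ℤ

  -- Declared before the operations of ℤ[φ], so that here _+_ and _*_ are those of ℤ.
  private
    module Coordinates where
      open import Data.Integer using (_+_; _*_)

      *-assoc₁ : ∀ a b c d e f → (a * c + b * d) * e + (a * d + b * c + b * d) * f
                                 ≡ a * (c * e + d * f) + b * (c * f + d * e + d * f)
      *-assoc₁ = solve-∀
      *-assoc₂ : ∀ a b c d e f → (a * c + b * d) * f + (a * d + b * c + b * d) * e + (a * d + b * c + b * d) * f
                                 ≡ a * (c * f + d * e + d * f) + b * (c * e + d * f) + b * (c * f + d * e + d * f)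
      *-assoc₂ = solve-∀
      *-comm₁ : ∀ a b c d → a * c + b * d ≡ c * a + d * b
      *-comm₁ = solve-∀
      *-comm₂ : ∀ a b c d → a * d + b * c + b * d ≡ c * b + d * a + d * b
      *-comm₂ = solve-∀
      *-identityˡ₁ : ∀ a b → 1ℤ * a + 0ℤ * b ≡ a
      *-identityˡ₁ = solve-∀
      *-identityˡ₂ : ∀ a b → 1ℤ * b + 0ℤ * a + 0ℤ * b ≡ b
      *-identityˡ₂ = solve-∀
      *-distribˡ-+₁ : ∀ a b c d e f → a * (c + e) + b * (d + f) ≡ a * c + b * d + (a * e + b * f)
      *-distribˡ-+₁ = solve-∀
      *-distribˡ-+₂ : ∀ a b c d e f → a * (d + f) + b * (c + e) + b * (d + f)
                                      ≡ a * d + b * c + b * d + (a * f + b * e + b * f)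
      *-distribˡ-+₂ = solve-∀
      conj-*₁ : ∀ a b c d → a * c + b * d + (a * d + b * c + b * d)
                            ≡ (a + b) * (c + d) + ℤ.- b * ℤ.- d
      conj-*₁ = solve-∀
      conj-*₂ : ∀ a b c d → ℤ.- (a * d + b * c + b * d)
                            ≡ (a + b) * ℤ.- d + ℤ.- b * (c + d) + ℤ.- b * ℤ.- d
      conj-*₂ = solve-∀
      conj-+₁ : ∀ a b c d → a + c + (b + d) ≡ a + b + (c + d)
      conj-+₁ = solve-∀
      ι-*₁ : ∀ a b → a * b ≡ a * b + 0ℤ * 0ℤ
      ι-*₁ = solve-∀
      ι-*₂ : ∀ a b → 0ℤ ≡ a * 0ℤ + 0ℤ * b + 0ℤ * 0ℤ
      ι-*₂ = solve-∀

  infixl 6 _+_ _-_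
  infixl 7 _*_
  infix 8 -_

  _+_ : ℤ[φ] → ℤ[φ] → ℤ[φ]
  (a , b) + (c , d) = (a ℤ.+ c , b ℤ.+ d)

  _*_ : ℤ[φ] → ℤ[φ] → ℤ[φ]
  (a , b) * (c , d) = (a ℤ.* c ℤ.+ b ℤ.* d , a ℤ.* d ℤ.+ b ℤ.* c ℤ.+ b ℤ.* d)

  -_ : ℤ[φ] → ℤ[φ]
  - (a , b) = (ℤ.- a , ℤ.- b)

  _-_ : ℤ[φ] → ℤ[φ] → ℤ[φ]
  x - y = x + - y

  0# 1# : ℤ[φ]
  0# = (0ℤ , 0ℤ)
  1# = (1ℤ , 0ℤ)

  private
    open Coordinates

    pair-≡ : ∀ {a b c d : ℤ} → a ≡ c → b ≡ d → (a , b) ≡ (c , d)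
    pair-≡ = cong₂ _,_

    *-assoc : ∀ x y z → (x * y) * z ≡ x * (y * z)
    *-assoc (a , b) (c , d) (e , f) = pair-≡ (*-assoc₁ a b c d e f) (*-assoc₂ a b c d e f)

    *-comm : ∀ x y → x * y ≡ y * x
    *-comm (a , b) (c , d) = pair-≡ (*-comm₁ a b c d) (*-comm₂ a b c d)

    *-identityˡ : ∀ x → 1# * x ≡ x
    *-identityˡ (a , b) = pair-≡ (*-identityˡ₁ a b) (*-identityˡ₂ a b)

    *-distribˡ-+ : ∀ x y z → x * (y + z) ≡ x * y + x * z
    *-distribˡ-+ (a , b) (c , d) (e , f) = pair-≡ (*-distribˡ-+₁ a b c d e f) (*-distribˡ-+₂ a b c d e f)

  ι : ℤ → ℤ[φ]
  ι a = (a , 0ℤ)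

  -- The Galois conjugation φ ↦ ψ = 1 - φ.
  conj : ℤ[φ] → ℤ[φ]
  conj (a , b) = (a ℤ.+ b , ℤ.- b)

  ι-* : ∀ a b → ι (a ℤ.* b) ≡ ι a * ι b
  ι-* a b = pair-≡ (ι-*₁ a b) (ι-*₂ a b)

  conj-+ : ∀ x y → conj (x + y) ≡ conj x + conj y
  conj-+ (a , b) (c , d) = pair-≡ (conj-+₁ a b c d) (ℤₚ.neg-distrib-+ b d)

  conj-* : ∀ x y → conj (x * y) ≡ conj x * conj y
  conj-* (a , b) (c , d) = pair-≡ (conj-*₁ a b c d) (conj-*₂ a b c d)

  conj-ι : ∀ a → conj (ι a) ≡ ι a
  conj-ι a = pair-≡ (ℤₚ.+-identityʳ a) refl

  ℤ[φ]-isCommutativeRing : IsCommutativeRing _≡_ _+_ _*_ -_ 0# 1#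
  ℤ[φ]-isCommutativeRing = record
    { isRing = record
      { +-isAbelianGroup = record
        { isGroup = record
          { isMonoid = record
            { isSemigroup = record
              { isMagma = record { isEquivalence = isEquivalence ; ∙-cong = cong₂ _+_ }
              ; assoc = λ (a , b) (c , d) (e , f) → pair-≡ (ℤₚ.+-assoc a c e) (ℤₚ.+-assoc b d f)
              }
            ; identity = (λ (a , b) → pair-≡ (ℤₚ.+-identityˡ a) (ℤₚ.+-identityˡ b))
                       , (λ (a , b) → pair-≡ (ℤₚ.+-identityʳ a) (ℤₚ.+-identityʳ b))
            }
          ; inverse = (λ (a , b) → pair-≡ (ℤₚ.+-inverseˡ a) (ℤₚ.+-inverseˡ b))
                    , (λ (a , b) → pair-≡ (ℤₚ.+-inverseʳ a) (ℤₚ.+-inverseʳ b))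
          ; ⁻¹-cong = cong (-_)
          }
        ; comm = λ (a , b) (c , d) → pair-≡ (ℤₚ.+-comm a c) (ℤₚ.+-comm b d)
        }
      ; *-cong = cong₂ _*_
      ; *-assoc = *-assoc
      ; *-identity = *-identityˡ , λ x → trans (*-comm x _) (*-identityˡ x)
      ; distrib = *-distribˡ-+
                , λ x y z → trans (*-comm (y + z) x) (trans (*-distribˡ-+ x y z) (cong₂ _+_ (*-comm x y) (*-comm x z)))
      }
    ; *-comm = *-comm
    }

  ℤ[φ]-commutativeRing : CommutativeRing 0ℓ 0ℓ
  ℤ[φ]-commutativeRing = record { isCommutativeRing = ℤ[φ]-isCommutativeRing }

  ℤ[φ]-ring : ACR.AlmostCommutativeRing 0ℓ 0ℓ
  ℤ[φ]-ring = ACR.fromCommutativeRing ℤ[φ]-commutativeRing is-zero?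
    where
    -- The solver needs to recognise zero coefficients: with `λ _ → nothing` identities involving `-_` fail.
    is-zero? : ∀ x → Maybe (0# ≡ x)
    is-zero? (+ zero , + zero) = just refl
    is-zero? _ = nothing

module GoldenArithmetic where
  open GoldenIntegers public
  open CommutativeRing ℤ[φ]-commutativeRing public
    using (+-assoc; +-identityʳ; *-comm; *-assoc; *-identityˡ; *-identityʳ; distribʳ; zeroˡ; zeroʳ; semiring; commutativeSemiring; *-commutativeSemigroup)
  open import Algebra.Properties.Semiring.Exp semiring public using (_^_; ^-assocʳ)
  open import Algebra.Properties.CommutativeSemiring.Exp commutativeSemiring public using (^-distrib-*)
  open import Algebra.Properties.CommutativeSemigroup *-commutativeSemigroup public using (x∙yz≈y∙xz)
  open ≡-Reasoning

  φ √5 : ℤ[φ]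
  φ = (0ℤ , 1ℤ)
  -- √5 = 2φ - 1 = φ - ψ
  √5 = (-1ℤ , + 2)

  √5*√5 : √5 * √5 ≡ ι (+ 5)
  √5*√5 = refl

  conj-√5 : conj √5 ≡ - √5
  conj-√5 = refl

  ι-^ : ∀ a n → ι (a ℤ.^ n) ≡ ι a ^ n
  ι-^ a zero = refl
  ι-^ a (suc n) = trans (ι-* a (a ℤ.^ n)) (cong (ι a *_) (ι-^ a n))

  conj-^ : ∀ x n → conj (x ^ n) ≡ conj x ^ n
  conj-^ x zero = refl
  conj-^ x (suc n) = trans (conj-* x (x ^ n)) (cong (conj x *_) (conj-^ x n))

  neg-^-odd : ∀ n x → n ℕ.% 2 ≡ 1 → (- x) ^ n ≡ - (x ^ n)
  neg-^-odd n x odd = begin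
    (- x) ^ n                ≡⟨ cong (_^ n) (neg-as-product x) ⟩
    (- 1# * x) ^ n           ≡⟨ ^-distrib-* (- 1#) x n ⟩
    (- 1#) ^ n * x ^ n       ≡⟨ cong (_* x ^ n) (trans (sym (ι-^ -1ℤ n)) (cong ι (FibonacciRecurrence.-1^odd n odd))) ⟩
    - 1# * x ^ n             ≡⟨ sym (neg-as-product (x ^ n)) ⟩
    - (x ^ n)                ∎
    where
    neg-as-product : ∀ x → - x ≡ - 1# * x
    neg-as-product = Solver.solve-∀ ℤ[φ]-ring

  ι-ℕ^ : ∀ a n → ι (+ (a ℕ.^ n)) ≡ ι (+ a) ^ n
  ι-ℕ^ a zero = refl
  ι-ℕ^ a (suc n) = begin
    ι (+ (a ℕ.* a ℕ.^ n))    ≡⟨ cong ι (ℤₚ.pos-* a (a ℕ.^ n)) ⟩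
    ι (+ a ℤ.* + (a ℕ.^ n))  ≡⟨ ι-* (+ a) (+ (a ℕ.^ n)) ⟩
    ι (+ a) * ι (+ (a ℕ.^ n)) ≡⟨ cong (ι (+ a) *_) (ι-ℕ^ a n) ⟩
    ι (+ a) * ι (+ a) ^ n    ∎

  ∑≤ : ℕ → (ℕ → ℤ[φ]) → ℤ[φ]
  ∑≤ zero f = f zero
  ∑≤ (suc n) f = ∑≤ n f + f (suc n)

  infix 5 ∑≤
  syntax ∑≤ n (λ k → e) = ∑[ k ≤ n ] e

  module _ {f g : ℕ → ℤ[φ]} where
    ∑-cong : ∀ n → (∀ k → f k ≡ g k) → ∑≤ n f ≡ ∑≤ n g
    ∑-cong zero f≗g = f≗g zero
    ∑-cong (suc n) f≗g = cong₂ _+_ (∑-cong n f≗g) (f≗g (suc n))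

    ∑-+ : ∀ n → ∑[ k ≤ n ] (f k + g k) ≡ ∑≤ n f + ∑≤ n g
    ∑-+ zero = refl
    ∑-+ (suc n) = trans (cong (_+ (f (suc n) + g (suc n))) (∑-+ n)) (interchange (∑≤ n f) (∑≤ n g) (f (suc n)) (g (suc n)))
      where
      interchange : ∀ a b c d → a + b + (c + d) ≡ a + c + (b + d)
      interchange = Solver.solve-∀ ℤ[φ]-ring

  ∑-*ʳ : ∀ n c (f : ℕ → ℤ[φ]) → ∑[ k ≤ n ] (f k * c) ≡ ∑≤ n f * c
  ∑-*ʳ zero c f = refl
  ∑-*ʳ (suc n) c f = trans (cong (_+ f (suc n) * c) (∑-*ʳ n c f)) (sym (distribʳ c (∑≤ n f) (f (suc n))))

  ∑-*ˡ : ∀ n c (f : ℕ → ℤ[φ]) → ∑[ k ≤ n ] (c * f k) ≡ c * ∑≤ n f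
  ∑-*ˡ n c f = trans (∑-cong n (λ k → *-comm c (f k))) (trans (∑-*ʳ n c f) (*-comm (∑≤ n f) c))

  ∑-shift : ∀ n (f : ℕ → ℤ[φ]) → ∑≤ (suc n) f ≡ f 0 + (∑[ k ≤ n ] f (suc k))
  ∑-shift zero f = refl
  ∑-shift (suc n) f = trans (cong (_+ f (2 ℕ.+ n)) (∑-shift n f)) (+-assoc (f 0) _ _)

  ∑-shift-vanishing : ∀ n (f : ℕ → ℤ[φ]) → f (suc n) ≡ 0# → f 0 + (∑[ k ≤ n ] f (suc k)) ≡ ∑≤ n f
  ∑-shift-vanishing n f fₙ₊₁≡0 = begin
    f 0 + (∑[ k ≤ n ] f (suc k))  ≡⟨ sym (∑-shift n f) ⟩
    ∑≤ n f + f (suc n)          ≡⟨ cong (λ t → ∑≤ n f + t) fₙ₊₁≡0 ⟩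
    ∑≤ n f + 0#                 ≡⟨ +-identityʳ (∑≤ n f) ⟩
    ∑≤ n f                      ∎

  conj-∑ : ∀ n (f : ℕ → ℤ[φ]) → conj (∑≤ n f) ≡ ∑[ k ≤ n ] conj (f k)
  conj-∑ zero f = refl
  conj-∑ (suc n) f = trans (conj-+ (∑≤ n f) (f (suc n))) (cong (_+ conj (f (suc n))) (conj-∑ n f))

  ι-sumTo : ∀ n (f : ℕ → ℤ) → ι (sumTo n f) ≡ ∑[ k ≤ n ] ι (f k)
  ι-sumTo zero f = refl
  ι-sumTo (suc n) f = cong (_+ ι (f (suc n))) (ι-sumTo n f)

module GoldenPowers where
  open GoldenArithmetic
  open FibonacciRecurrence using (fib-rec)
  open ≡-Reasoning

  -- φ^z = F_{z-1} + F_z φ holds for every integer z; we take it as the definition of φ^ z.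
  φ^_ : ℤ → ℤ[φ]
  φ^ z = (fib (ℤ.pred z) , fib z)

  φ⁻¹ : ℤ[φ]
  φ⁻¹ = φ^ -1ℤ

  φ^-suc : ∀ z → φ^ (ℤ.suc z) ≡ φ * φ^ z
  φ^-suc z = cong₂ _,_ (trans (cong fib (ℤₚ.pred-suc z)) (first (fib p) (fib z)))
    (begin
      fib (ℤ.suc z)                      ≡⟨ cong (fib ∘ ℤ.suc) (sym (ℤₚ.suc-pred z)) ⟩
      fib (ℤ.suc (ℤ.suc (ℤ.pred z)))     ≡⟨ fib-rec (ℤ.pred z) ⟩
      fib (ℤ.suc (ℤ.pred z)) ℤ.+ fib p   ≡⟨ cong (λ t → fib t ℤ.+ fib p) (ℤₚ.suc-pred z) ⟩
      fib z ℤ.+ fib p                    ≡⟨ as-product (fib p) (fib z) ⟩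
      (φ * φ^ z) .proj₂                  ∎)
    where
    p = ℤ.pred z
    first : ∀ a b → b ≡ 0ℤ ℤ.* a ℤ.+ 1ℤ ℤ.* b
    first = solve-∀
    as-product : ∀ a b → b ℤ.+ a ≡ 0ℤ ℤ.* b ℤ.+ 1ℤ ℤ.* a ℤ.+ 1ℤ ℤ.* b
    as-product = solve-∀

  φ^-pred : ∀ z → φ^ (ℤ.pred z) ≡ φ⁻¹ * φ^ z
  φ^-pred z = begin
    φ^ (ℤ.pred z)                ≡⟨ sym (*-identityˡ (φ^ (ℤ.pred z))) ⟩
    (φ⁻¹ * φ) * φ^ (ℤ.pred z)    ≡⟨ *-assoc φ⁻¹ φ (φ^ (ℤ.pred z)) ⟩
    φ⁻¹ * (φ * φ^ (ℤ.pred z))    ≡⟨ cong (φ⁻¹ *_) (sym (φ^-suc (ℤ.pred z))) ⟩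
    φ⁻¹ * φ^ (ℤ.suc (ℤ.pred z))  ≡⟨ cong (λ t → φ⁻¹ * φ^ t) (ℤₚ.suc-pred z) ⟩
    φ⁻¹ * φ^ z                   ∎

  φ^-+ : ∀ z w → φ^ (z ℤ.+ w) ≡ φ^ z * φ^ w
  φ^-+ z (+ zero) = trans (cong φ^_ (ℤₚ.+-identityʳ z)) (sym (*-identityʳ (φ^ z)))
  φ^-+ z (+ suc m) = begin
    φ^ (z ℤ.+ ℤ.suc (+ m))  ≡⟨ cong φ^_ (+-suc z (+ m)) ⟩
    φ^ (ℤ.suc (z ℤ.+ + m))  ≡⟨ φ^-suc (z ℤ.+ + m) ⟩
    φ * φ^ (z ℤ.+ + m)      ≡⟨ cong (φ *_) (φ^-+ z (+ m)) ⟩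
    φ * (φ^ z * φ^ (+ m))   ≡⟨ x∙yz≈y∙xz φ (φ^ z) (φ^ (+ m)) ⟩
    φ^ z * (φ * φ^ (+ m))   ≡⟨ cong (φ^ z *_) (sym (φ^-suc (+ m))) ⟩
    φ^ z * φ^ (+ suc m)     ∎
    where
    +-suc : ∀ z w → z ℤ.+ (1ℤ ℤ.+ w) ≡ 1ℤ ℤ.+ (z ℤ.+ w)
    +-suc = solve-∀
  φ^-+ z -[1+ zero ] = trans (cong φ^_ (ℤₚ.+-comm z -1ℤ)) (trans (φ^-pred z) (*-comm φ⁻¹ (φ^ z)))
  φ^-+ z -[1+ suc m ] = begin
    φ^ (z ℤ.+ ℤ.pred -[1+ m ])  ≡⟨ cong φ^_ (ℤₚ.+-pred z -[1+ m ]) ⟩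
    φ^ (ℤ.pred (z ℤ.+ -[1+ m ]))  ≡⟨ φ^-pred (z ℤ.+ -[1+ m ]) ⟩
    φ⁻¹ * φ^ (z ℤ.+ -[1+ m ])     ≡⟨ cong (φ⁻¹ *_) (φ^-+ z -[1+ m ]) ⟩
    φ⁻¹ * (φ^ z * φ^ -[1+ m ])    ≡⟨ x∙yz≈y∙xz φ⁻¹ (φ^ z) (φ^ -[1+ m ]) ⟩
    φ^ z * (φ⁻¹ * φ^ -[1+ m ])    ≡⟨ cong (φ^ z *_) (sym (φ^-pred -[1+ m ])) ⟩
    φ^ z * φ^ -[1+ suc m ]        ∎

  φ^-ℕ : ∀ n → φ^ (+ n) ≡ φ ^ n
  φ^-ℕ zero = refl
  φ^-ℕ (suc n) = trans (φ^-suc (+ n)) (cong (φ *_) (φ^-ℕ n))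

  fib-√5 : ∀ z → ι (fib z) * √5 ≡ φ^ z - conj (φ^ z)
  fib-√5 z = cong₂ _,_ (first (fib (ℤ.pred z)) (fib z)) (second (fib z))
    where
    first : ∀ p f → f ℤ.* -1ℤ ℤ.+ 0ℤ ℤ.* + 2 ≡ p ℤ.+ ℤ.- (p ℤ.+ f)
    first = solve-∀
    second : ∀ f → f ℤ.* + 2 ℤ.+ 0ℤ ℤ.* -1ℤ ℤ.+ 0ℤ ℤ.* + 2 ≡ f ℤ.+ ℤ.- ℤ.- f
    second = solve-∀

module EvenBinomialSums where
  open GoldenArithmetic
  open import Data.Nat.Combinatorics using (_C_; nCk+nC[k+1]≡[n+1]C[k+1]; k>n⇒nCk≡0; nC1≡n)
  open ≡-Reasoning

  fromℕ : ℕ → ℤ[φ]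
  fromℕ m = ι (+ m)

  evenBinomial oddBinomial : ℕ → ℤ[φ] → ℤ[φ]
  evenBinomial n y = ∑[ k ≤ n ] fromℕ ((2 ℕ.* n) C (2 ℕ.* k)) * y ^ k
  oddBinomial n y = ∑[ k ≤ n ] fromℕ ((2 ℕ.* n) C suc (2 ℕ.* k)) * y ^ k

  private
    2+2* : ∀ n → 2 ℕ.* suc n ≡ suc (suc (2 ℕ.* n))
    2+2* n = ℕₚ.*-suc 2 n

    pascal² : ∀ m j → fromℕ (suc (suc m) C suc (suc j))
                    ≡ fromℕ (m C j) + fromℕ (m C suc j) + (fromℕ (m C suc j) + fromℕ (m C suc (suc j)))
    pascal² m j = cong (ι ∘ +_) (begin
      suc (suc m) C suc (suc j)                              ≡⟨ sym (nCk+nC[k+1]≡[n+1]C[k+1] (suc m) (suc j)) ⟩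
      suc m C suc j ℕ.+ suc m C suc (suc j)                  ≡⟨ sym (cong₂ ℕ._+_ (nCk+nC[k+1]≡[n+1]C[k+1] m j)
                                                                                 (nCk+nC[k+1]≡[n+1]C[k+1] m (suc j))) ⟩
      m C j ℕ.+ m C suc j ℕ.+ (m C suc j ℕ.+ m C suc (suc j)) ∎)

    top-term-vanishes : ∀ n j y → 2 ℕ.* n ℕ.< j → fromℕ ((2 ℕ.* n) C j) * y ≡ 0#
    top-term-vanishes n j y 2n<j = trans (cong (λ c → fromℕ c * y) (k>n⇒nCk≡0 2n<j)) (zeroˡ y)

    pascal-step : ∀ m j y t → fromℕ (suc (suc m) C suc (suc j)) * (y * t)
                              ≡ fromℕ (m C suc (suc j)) * (y * t)
                                + (1# + 1#) * (fromℕ (m C suc j) * (y * t)) + y * (fromℕ (m C j) * t)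
    pascal-step m j y t = trans (cong (_* (y * t)) (pascal² m j))
                                (expand (fromℕ (m C j)) (fromℕ (m C suc j)) (fromℕ (m C suc (suc j))) y t)
      where
      expand : ∀ a b c y t → (a + b + (b + c)) * (y * t) ≡ c * (y * t) + (1# + 1#) * (b * (y * t)) + y * (a * t)
      expand = Solver.solve-∀ ℤ[φ]-ring

  module _ (n : ℕ) (y : ℤ[φ]) where
    private
      e o : ℕ → ℤ[φ]
      e k = fromℕ ((2 ℕ.* n) C (2 ℕ.* k)) * y ^ k
      o k = fromℕ ((2 ℕ.* n) C suc (2 ℕ.* k)) * y ^ k

      E O : ℤ[φ]
      E = evenBinomial n y
      O = oddBinomial n y

      2n<2[n+1] : 2 ℕ.* n ℕ.< 2 ℕ.* suc n
      2n<2[n+1] = ℕₚ.*-monoʳ-< 2 (ℕₚ.n<1+n n)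

      e-shift : 1# + ∑≤ n (e ∘ suc) ≡ E
      e-shift = ∑-shift-vanishing n e (top-term-vanishes n (2 ℕ.* suc n) (y ^ suc n) 2n<2[n+1])

      o-shift : o 0 + ∑≤ n (o ∘ suc) ≡ O
      o-shift = ∑-shift-vanishing n o (top-term-vanishes n (suc (2 ℕ.* suc n)) (y ^ suc n) (ℕₚ.m<n⇒m<1+n 2n<2[n+1]))

    evenBinomial-suc : evenBinomial (suc n) y ≡ (1# + y) * E + (1# + 1#) * y * O
    evenBinomial-suc = begin
      evenBinomial (suc n) y                                 ≡⟨ ∑-shift n g ⟩
      1# + (∑[ k ≤ n ] g (suc k))                            ≡⟨ cong (λ t → 1# + t) (∑-cong n step) ⟩
      1# + (∑[ k ≤ n ] (e (suc k) + (1# + 1#) * y * o k + y * e k))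
        ≡⟨ cong (λ t → 1# + t) (trans (∑-+ n) (cong₂ _+_ (trans (∑-+ n) (cong (λ t → ∑≤ n (e ∘ suc) + t)
                                 (∑-*ˡ n ((1# + 1#) * y) o))) (∑-*ˡ n y e))) ⟩
      1# + (∑≤ n (e ∘ suc) + (1# + 1#) * y * O + y * E)    ≡⟨ regroup 1# (∑≤ n (e ∘ suc)) ((1# + 1#) * y * O) (y * E) ⟩
      1# + ∑≤ n (e ∘ suc) + y * E + (1# + 1#) * y * O      ≡⟨ cong (λ t → t + y * E + (1# + 1#) * y * O) e-shift ⟩
      E + y * E + (1# + 1#) * y * O                        ≡⟨ factor E y ((1# + 1#) * y * O) ⟩
      (1# + y) * E + (1# + 1#) * y * O                     ∎
      where
      g : ℕ → ℤ[φ]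
      g k = fromℕ ((2 ℕ.* suc n) C (2 ℕ.* k)) * y ^ k
      step : ∀ k → g (suc k) ≡ e (suc k) + (1# + 1#) * y * o k + y * e k
      step k = begin
        fromℕ ((2 ℕ.* suc n) C (2 ℕ.* suc k)) * (y * y ^ k)
          ≡⟨ cong₂ (λ a b → fromℕ (a C b) * (y * y ^ k)) (2+2* n) (2+2* k) ⟩
        fromℕ (suc (suc (2 ℕ.* n)) C suc (suc (2 ℕ.* k))) * (y * y ^ k)
          ≡⟨ pascal-step (2 ℕ.* n) (2 ℕ.* k) y (y ^ k) ⟩
        fromℕ ((2 ℕ.* n) C suc (suc (2 ℕ.* k))) * (y * y ^ k) + (1# + 1#) * (b * (y * y ^ k)) + y * e k
          ≡⟨ cong₂ (λ j u → fromℕ ((2 ℕ.* n) C j) * (y * y ^ k) + u + y * e k) (sym (2+2* k)) (swap b y (y ^ k)) ⟩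
        e (suc k) + (1# + 1#) * y * o k + y * e k          ∎
        where
        b = fromℕ ((2 ℕ.* n) C suc (2 ℕ.* k))
        swap : ∀ b y t → (1# + 1#) * (b * (y * t)) ≡ (1# + 1#) * y * (b * t)
        swap = Solver.solve-∀ ℤ[φ]-ring
      regroup : ∀ a s u v → a + (s + u + v) ≡ a + s + v + u
      regroup = Solver.solve-∀ ℤ[φ]-ring
      factor : ∀ E y u → E + y * E + u ≡ (1# + y) * E + u
      factor = Solver.solve-∀ ℤ[φ]-ring

    oddBinomial-suc : oddBinomial (suc n) y ≡ (1# + y) * O + (1# + 1#) * E
    oddBinomial-suc = begin
      oddBinomial (suc n) y                                 ≡⟨ ∑-shift n g ⟩
      g 0 + (∑[ k ≤ n ] g (suc k))                          ≡⟨ cong₂ _+_ g₀ (∑-cong n step) ⟩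
      o 0 + (1# + 1#) + (∑[ k ≤ n ] (o (suc k) + (1# + 1#) * e (suc k) + y * o k))
        ≡⟨ cong (λ t → o 0 + (1# + 1#) + t) (trans (∑-+ n) (cong₂ _+_ (trans (∑-+ n) (cong (λ t → ∑≤ n (o ∘ suc) + t)
                                 (∑-*ˡ n (1# + 1#) (e ∘ suc)))) (∑-*ˡ n y o))) ⟩
      o 0 + (1# + 1#) + (∑≤ n (o ∘ suc) + (1# + 1#) * ∑≤ n (e ∘ suc) + y * O)
        ≡⟨ regroup (o 0) (∑≤ n (o ∘ suc)) (∑≤ n (e ∘ suc)) (y * O) ⟩
      o 0 + ∑≤ n (o ∘ suc) + y * O + (1# + 1#) * (1# + ∑≤ n (e ∘ suc))
        ≡⟨ cong₂ (λ u v → u + y * O + (1# + 1#) * v) o-shift e-shift ⟩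
      O + y * O + (1# + 1#) * E                             ≡⟨ factor O y ((1# + 1#) * E) ⟩
      (1# + y) * O + (1# + 1#) * E                          ∎
      where
      g : ℕ → ℤ[φ]
      g k = fromℕ ((2 ℕ.* suc n) C suc (2 ℕ.* k)) * y ^ k
      g₀ : g 0 ≡ o 0 + (1# + 1#)
      g₀ = begin
        fromℕ ((2 ℕ.* suc n) C 1) * 1#                     ≡⟨ cong (λ c → fromℕ c * 1#) (trans (nC1≡n (2 ℕ.* suc n)) (2+2* n)) ⟩
        fromℕ (2 ℕ.+ 2 ℕ.* n) * 1#                         ≡⟨ add-two (fromℕ (2 ℕ.* n)) ⟩
        fromℕ (2 ℕ.* n) * 1# + (1# + 1#)                   ≡⟨ cong (λ c → fromℕ c * 1# + (1# + 1#)) (sym (nC1≡n (2 ℕ.* n))) ⟩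
        o 0 + (1# + 1#)                                    ∎
        where
        add-two : ∀ a → (1# + 1# + a) * 1# ≡ a * 1# + (1# + 1#)
        add-two = Solver.solve-∀ ℤ[φ]-ring
      step : ∀ k → g (suc k) ≡ o (suc k) + (1# + 1#) * e (suc k) + y * o k
      step k = begin
        fromℕ ((2 ℕ.* suc n) C suc (2 ℕ.* suc k)) * (y * y ^ k)
          ≡⟨ cong₂ (λ a b → fromℕ (a C suc b) * (y * y ^ k)) (2+2* n) (2+2* k) ⟩
        fromℕ (suc (suc (2 ℕ.* n)) C suc (suc (suc (2 ℕ.* k)))) * (y * y ^ k)
          ≡⟨ pascal-step (2 ℕ.* n) (suc (2 ℕ.* k)) y (y ^ k) ⟩
        fromℕ ((2 ℕ.* n) C suc (suc (suc (2 ℕ.* k)))) * (y * y ^ k)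
          + (1# + 1#) * (fromℕ ((2 ℕ.* n) C suc (suc (2 ℕ.* k))) * (y * y ^ k)) + y * o k
          ≡⟨ cong (λ j → fromℕ ((2 ℕ.* n) C suc j) * (y * y ^ k) + (1# + 1#) * (fromℕ ((2 ℕ.* n) C j) * (y * y ^ k)) + y * o k)
                  (sym (2+2* k)) ⟩
        o (suc k) + (1# + 1#) * e (suc k) + y * o k        ∎
      regroup : ∀ a s t u → a + (1# + 1#) + (s + (1# + 1#) * t + u) ≡ a + s + u + (1# + 1#) * (1# + t)
      regroup = Solver.solve-∀ ℤ[φ]-ring
      factor : ∀ O y u → O + y * O + u ≡ (1# + y) * O + u
      factor = Solver.solve-∀ ℤ[φ]-ring

  binomial-square-power : ∀ n x → ((1# + x) * (1# + x)) ^ n ≡ evenBinomial n (x * x) + x * oddBinomial n (x * x)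
  binomial-square-power zero x = begin
    1#                                                 ≡⟨ sym (+-identityʳ 1#) ⟩
    1# + 0#                                            ≡⟨ cong (λ t → 1# + t) (sym (zeroʳ x)) ⟩
    evenBinomial 0 (x * x) + x * oddBinomial 0 (x * x) ∎
  binomial-square-power (suc n) x = begin
    (1# + x) * (1# + x) * ((1# + x) * (1# + x)) ^ n
      ≡⟨ cong ((1# + x) * (1# + x) *_) (binomial-square-power n x) ⟩
    (1# + x) * (1# + x) * (E + x * O)
      ≡⟨ expand x E O ⟩
    ((1# + x * x) * E + (1# + 1#) * (x * x) * O) + x * ((1# + x * x) * O + (1# + 1#) * E)
      ≡⟨ sym (cong₂ (λ u v → u + x * v) (evenBinomial-suc n (x * x)) (oddBinomial-suc n (x * x))) ⟩
    evenBinomial (suc n) (x * x) + x * oddBinomial (suc n) (x * x) ∎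
    where
    E = evenBinomial n (x * x)
    O = oddBinomial n (x * x)
    expand : ∀ x E O → (1# + x) * (1# + x) * (E + x * O)
                       ≡ ((1# + x * x) * E + (1# + 1#) * (x * x) * O) + x * ((1# + x * x) * O + (1# + 1#) * E)
    expand = Solver.solve-∀ ℤ[φ]-ring

  twice-evenBinomial : ∀ n x → (1# + 1#) * evenBinomial n (x * x)
                               ≡ ((1# + x) * (1# + x)) ^ n + ((1# - x) * (1# - x)) ^ n
  twice-evenBinomial n x = begin
    (1# + 1#) * E                                   ≡⟨ split E O x ⟩
    (E + x * O) + (E + - x * O)                     ≡⟨ cong (λ y → (E + x * O) + (evenBinomial n y + - x * oddBinomial n y))
                                                            (sym (neg*neg x)) ⟩
    (E + x * O) + (evenBinomial n (- x * - x) + - x * oddBinomial n (- x * - x))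
      ≡⟨ sym (cong₂ _+_ (binomial-square-power n x) (binomial-square-power n (- x))) ⟩
    ((1# + x) * (1# + x)) ^ n + ((1# - x) * (1# - x)) ^ n ∎
    where
    E = evenBinomial n (x * x)
    O = oddBinomial n (x * x)
    split : ∀ E O x → (1# + 1#) * E ≡ (E + x * O) + (E + - x * O)
    split = Solver.solve-∀ ℤ[φ]-ring
    neg*neg : ∀ x → - x * - x ≡ x * x
    neg*neg = Solver.solve-∀ ℤ[φ]-ring

module AlternatingBinomialSum where
  open import Data.Integer using (_+_; _*_; -_; _^_)
  open import Data.Nat.Combinatorics using (_C_; nCk≡nC[n∸k])
  open FibonacciRecurrence using (-1^odd)
  open ≡-Reasoning

  sumTo-shift : ∀ n f → sumTo (suc n) f ≡ f 0 + sumTo n (f ∘ suc)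
  sumTo-shift zero f = refl
  sumTo-shift (suc n) f = trans (cong (_+ f (2 ℕ.+ n)) (sumTo-shift n f)) (ℤₚ.+-assoc (f 0) _ _)

  sumTo-reverse : ∀ n f → sumTo n f ≡ sumTo n (λ k → f (n ℕ.∸ k))
  sumTo-reverse zero f = refl
  sumTo-reverse (suc n) f = begin
    sumTo n f + f (suc n)                        ≡⟨ cong (_+ f (suc n)) (sumTo-reverse n f) ⟩
    sumTo n (λ k → f (n ℕ.∸ k)) + f (suc n)      ≡⟨ ℤₚ.+-comm _ (f (suc n)) ⟩
    f (suc n) + sumTo n (λ k → f (n ℕ.∸ k))      ≡⟨ sym (sumTo-shift n (λ k → f (suc n ℕ.∸ k))) ⟩
    sumTo (suc n) (λ k → f (suc n ℕ.∸ k))        ∎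

  sumTo-cong-≤ : ∀ n {f g} → (∀ k → k ℕ.≤ n → f k ≡ g k) → sumTo n f ≡ sumTo n g
  sumTo-cong-≤ zero f≗g = f≗g zero ℕ.z≤n
  sumTo-cong-≤ (suc n) f≗g =
    cong₂ _+_ (sumTo-cong-≤ n (λ k k≤n → f≗g k (ℕₚ.m≤n⇒m≤1+n k≤n))) (f≗g (suc n) ℕₚ.≤-refl)

  sumTo-neg : ∀ n f → sumTo n (λ k → - f k) ≡ - sumTo n f
  sumTo-neg zero f = refl
  sumTo-neg (suc n) f = trans (cong (_+ - f (suc n)) (sumTo-neg n f)) (sym (ℤₚ.neg-distrib-+ (sumTo n f) (f (suc n))))

  self-negating : ∀ s → s ≡ - s → s ≡ 0ℤ
  self-negating s s≡-s = ℤₚ.*-cancelˡ-≡ (+ 2) s 0ℤ (begin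
    + 2 * s  ≡⟨ double s ⟩
    s + s    ≡⟨ cong (λ t → s + t) s≡-s ⟩
    s + - s  ≡⟨ ℤₚ.+-inverseʳ s ⟩
    0ℤ       ∎)
    where
    double : ∀ s → + 2 * s ≡ s + s
    double = solve-∀

  -1^-square : ∀ k → -1ℤ ^ k * -1ℤ ^ k ≡ 1ℤ
  -1^-square zero = refl
  -1^-square (suc k) = trans (negate-twice (-1ℤ ^ k)) (-1^-square k)
    where
    negate-twice : ∀ σ → -1ℤ * σ * (-1ℤ * σ) ≡ σ * σ
    negate-twice = solve-∀

  -1^-reflect : ∀ n k → n ℕ.% 2 ≡ 1 → k ℕ.≤ n → -1ℤ ^ (n ℕ.∸ k) ≡ - (-1ℤ ^ k)
  -1^-reflect n k odd k≤n = begin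
    σ                  ≡⟨ sym (ℤₚ.*-identityʳ σ) ⟩
    σ * 1ℤ             ≡⟨ cong (σ *_) (sym (-1^-square k)) ⟩
    σ * (τ * τ)        ≡⟨ sym (ℤₚ.*-assoc σ τ τ) ⟩
    σ * τ * τ          ≡⟨ cong (_* τ) (sym (ℤₚ.^-distribˡ-+-* -1ℤ (n ℕ.∸ k) k)) ⟩
    -1ℤ ^ (n ℕ.∸ k ℕ.+ k) * τ ≡⟨ cong (λ m → -1ℤ ^ m * τ) (ℕₚ.m∸n+n≡m k≤n) ⟩
    -1ℤ ^ n * τ        ≡⟨ cong (_* τ) (-1^odd n odd) ⟩
    -1ℤ * τ            ≡⟨ ℤₚ.-1*i≡-i τ ⟩
    - τ                ∎
    where
    σ = -1ℤ ^ (n ℕ.∸ k)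
    τ = -1ℤ ^ k

  alternating-evenBinomial : ∀ n → n ℕ.% 2 ≡ 1 →
    sumTo n (λ k → + ((2 ℕ.* n) C (2 ℕ.* k)) * -1ℤ ^ k) ≡ 0ℤ
  alternating-evenBinomial n odd = self-negating (sumTo n g) (begin
    sumTo n g                         ≡⟨ sumTo-reverse n g ⟩
    sumTo n (λ k → g (n ℕ.∸ k))       ≡⟨ sumTo-cong-≤ n reflect ⟩
    sumTo n (λ k → - g k)             ≡⟨ sumTo-neg n g ⟩
    - sumTo n g                       ∎)
    where
    g : ℕ → ℤ
    g k = + ((2 ℕ.* n) C (2 ℕ.* k)) * -1ℤ ^ k
    C-reflect : ∀ k → k ℕ.≤ n → (2 ℕ.* n) C (2 ℕ.* (n ℕ.∸ k)) ≡ (2 ℕ.* n) C (2 ℕ.* k)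
    C-reflect k k≤n = trans (cong ((2 ℕ.* n) C_) (ℕₚ.*-distribˡ-∸ 2 n k))
                            (sym (nCk≡nC[n∸k] (ℕₚ.*-monoʳ-≤ 2 k≤n)))
    reflect : ∀ k → k ℕ.≤ n → g (n ℕ.∸ k) ≡ - g k
    reflect k k≤n = trans (cong₂ (λ c σ → + c * σ) (C-reflect k k≤n) (-1^-reflect n k odd k≤n))
                          (sym (ℤₚ.neg-distribʳ-* (+ ((2 ℕ.* n) C (2 ℕ.* k))) (-1ℤ ^ k)))

module FibonacciProductSum where
  open GoldenArithmetic
  open GoldenPowers
  open EvenBinomialSums
  open import Data.Nat.Combinatorics using (_C_)
  open ≡-Reasoning

  u : ℤ[φ]
  u = φ ^ 3

  u*ū : u * conj u ≡ - 1#
  u*ū = refl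

  [1+u]² : (1# + u) * (1# + u) ≡ ι (+ 4) * (u * φ)
  [1+u]² = refl

  [1-u]² : (1# - u) * (1# - u) ≡ ι (+ 4) * - (u * conj φ)
  [1-u]² = refl

  φ^-3k+ : ∀ k z → φ^ (+ (3 ℕ.* k) ℤ.+ z) ≡ u ^ k * φ^ z
  φ^-3k+ k z = begin
    φ^ (+ (3 ℕ.* k) ℤ.+ z)    ≡⟨ φ^-+ (+ (3 ℕ.* k)) z ⟩
    φ^ (+ (3 ℕ.* k)) * φ^ z   ≡⟨ cong (_* φ^ z) (trans (φ^-ℕ (3 ℕ.* k)) (sym (^-assocʳ φ 3 k))) ⟩
    u ^ k * φ^ z              ∎

  conj-φ^-3k+ : ∀ k z → conj (φ^ (+ (3 ℕ.* k) ℤ.+ z)) ≡ conj u ^ k * conj (φ^ z)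
  conj-φ^-3k+ k z = begin
    conj (φ^ (+ (3 ℕ.* k) ℤ.+ z))  ≡⟨ cong conj (φ^-3k+ k z) ⟩
    conj (u ^ k * φ^ z)            ≡⟨ conj-* (u ^ k) (φ^ z) ⟩
    conj (u ^ k) * conj (φ^ z)     ≡⟨ cong (_* conj (φ^ z)) (conj-^ u k) ⟩
    conj u ^ k * conj (φ^ z)       ∎

  u^k*ū^k : ∀ k → u ^ k * conj u ^ k ≡ ι (-1ℤ ℤ.^ k)
  u^k*ū^k k = begin
    u ^ k * conj u ^ k    ≡⟨ ^-distrib-* u (conj u) k ⟨
    (u * conj u) ^ k      ≡⟨ cong (_^ k) u*ū ⟩
    (- 1#) ^ k            ≡⟨ ι-^ -1ℤ k ⟨
    ι (-1ℤ ℤ.^ k)         ∎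

  -- For odd n, φ^{2n} = -φ^{3n}ψ^n, so the two binomial powers combine to φ^{3n}(φ^n - ψ^n).
  twice-evenBinomial-u : ∀ n → n ℕ.% 2 ≡ 1 →
    (1# + 1#) * evenBinomial n (u * u) ≡ ι (+ (4 ℕ.^ n)) * u ^ n * (ι (fib (+ n)) * √5)
  twice-evenBinomial-u n odd = begin
    (1# + 1#) * evenBinomial n (u * u)
      ≡⟨ twice-evenBinomial n u ⟩
    ((1# + u) * (1# + u)) ^ n + ((1# - u) * (1# - u)) ^ n
      ≡⟨ cong₂ (λ x y → x ^ n + y ^ n) [1+u]² [1-u]² ⟩
    (ι (+ 4) * (u * φ)) ^ n + (ι (+ 4) * - (u * conj φ)) ^ n
      ≡⟨ cong₂ _+_ (^-distrib-* (ι (+ 4)) (u * φ) n) (^-distrib-* (ι (+ 4)) (- (u * conj φ)) n) ⟩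
    ι (+ 4) ^ n * (u * φ) ^ n + ι (+ 4) ^ n * (- (u * conj φ)) ^ n
      ≡⟨ cong₂ (λ x y → ι (+ 4) ^ n * x + ι (+ 4) ^ n * y) (^-distrib-* u φ n)
               (trans (neg-^-odd n (u * conj φ) odd) (cong -_ (^-distrib-* u (conj φ) n))) ⟩
    ι (+ 4) ^ n * (u ^ n * φ ^ n) + ι (+ 4) ^ n * - (u ^ n * conj φ ^ n)
      ≡⟨ factor (ι (+ 4) ^ n) (u ^ n) (φ ^ n) (conj φ ^ n) ⟩
    ι (+ 4) ^ n * u ^ n * (φ ^ n - conj φ ^ n)
      ≡⟨ cong (λ x → ι (+ 4) ^ n * u ^ n * (φ ^ n - x)) (conj-^ φ n) ⟨
    ι (+ 4) ^ n * u ^ n * (φ ^ n - conj (φ ^ n))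
      ≡⟨ cong₂ (λ c x → c * u ^ n * (x - conj x)) (ι-ℕ^ 4 n) (φ^-ℕ n) ⟨
    ι (+ (4 ℕ.^ n)) * u ^ n * (φ^ (+ n) - conj (φ^ (+ n)))
      ≡⟨ cong (ι (+ (4 ℕ.^ n)) * u ^ n *_) (fib-√5 (+ n)) ⟨
    ι (+ (4 ℕ.^ n)) * u ^ n * (ι (fib (+ n)) * √5) ∎
    where
    factor : ∀ c p x y → c * (p * x) + c * - (p * y) ≡ c * p * (x + - y)
    factor = Solver.solve-∀ ℤ[φ]-ring

  module _ (n : ℕ) (r s : ℤ) where
    A B W goldenPart : ℤ[φ]
    A = φ^ r
    B = φ^ s
    W = A * conj B + conj A * B
    goldenPart = evenBinomial n (u * u) * (A * B)

    binom : ℕ → ℤ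
    binom k = + ((2 ℕ.* n) C (2 ℕ.* k))

    productSum alternatingSum : ℤ
    productSum = sumTo n (λ k → binom k ℤ.* fib (+ (3 ℕ.* k) ℤ.+ r) ℤ.* fib (+ (3 ℕ.* k) ℤ.+ s))
    alternatingSum = sumTo n (λ k → binom k ℤ.* -1ℤ ℤ.^ k)

    -- 5 F_a F_b = (φ^a - ψ^a)(φ^b - ψ^b), and φ^{3k} ψ^{3k} = (-1)^k.
    five-times-term : ∀ k → ι (binom k ℤ.* fib (+ (3 ℕ.* k) ℤ.+ r) ℤ.* fib (+ (3 ℕ.* k) ℤ.+ s)) * ι (+ 5)
                            ≡ fromℕ ((2 ℕ.* n) C (2 ℕ.* k)) * (u * u) ^ k * (A * B)
                              + conj (fromℕ ((2 ℕ.* n) C (2 ℕ.* k)) * (u * u) ^ k * (A * B))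
                              + ι (binom k ℤ.* -1ℤ ℤ.^ k) * - W
    five-times-term k = begin
      ι (binom k ℤ.* Fr ℤ.* Fs) * ι (+ 5)
        ≡⟨ cong₂ _*_ (trans (ι-* (binom k ℤ.* Fr) Fs) (cong (_* ι Fs) (ι-* (binom k) Fr))) (sym √5*√5) ⟩
      c * ι Fr * ι Fs * (√5 * √5)
        ≡⟨ regroup c (ι Fr) (ι Fs) √5 ⟩
      c * (ι Fr * √5) * (ι Fs * √5)
        ≡⟨ cong₂ (λ a b → c * a * b) (fib-√5 (+ (3 ℕ.* k) ℤ.+ r)) (fib-√5 (+ (3 ℕ.* k) ℤ.+ s)) ⟩
      c * (φ^ (+ (3 ℕ.* k) ℤ.+ r) - conj (φ^ (+ (3 ℕ.* k) ℤ.+ r)))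
        * (φ^ (+ (3 ℕ.* k) ℤ.+ s) - conj (φ^ (+ (3 ℕ.* k) ℤ.+ s)))
        ≡⟨ cong₂ (λ a b → c * a * b) (cong₂ _-_ (φ^-3k+ k r) (conj-φ^-3k+ k r))
                                     (cong₂ _-_ (φ^-3k+ k s) (conj-φ^-3k+ k s)) ⟩
      c * (p * A - q * conj A) * (p * B - q * conj B)
        ≡⟨ expand c p q A B (conj A) (conj B) ⟩
      c * (p * p) * (A * B) + c * (q * q) * (conj A * conj B) + c * (p * q) * - W
        ≡⟨ cong₂ (λ x y → c * x * (A * B) + c * y * (conj A * conj B) + c * (p * q) * - W)
                 (^-distrib-* u u k) (^-distrib-* (conj u) (conj u) k) ⟨
      c * (u * u) ^ k * (A * B) + c * (conj u * conj u) ^ k * (conj A * conj B) + c * (p * q) * - W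
        ≡⟨ cong₂ (λ x y → c * (u * u) ^ k * (A * B) + x + y * - W) (sym conjugate-term)
                 (trans (cong (c *_) (u^k*ū^k k)) (sym (ι-* (binom k) (-1ℤ ℤ.^ k)))) ⟩
      c * (u * u) ^ k * (A * B) + conj (c * (u * u) ^ k * (A * B)) + ι (binom k ℤ.* -1ℤ ℤ.^ k) * - W ∎
      where
      Fr = fib (+ (3 ℕ.* k) ℤ.+ r)
      Fs = fib (+ (3 ℕ.* k) ℤ.+ s)
      c = ι (binom k)
      p = u ^ k
      q = conj u ^ k
      conjugate-term : conj (c * (u * u) ^ k * (A * B)) ≡ c * (conj u * conj u) ^ k * (conj A * conj B)
      conjugate-term = begin
        conj (c * (u * u) ^ k * (A * B))                 ≡⟨ conj-* (c * (u * u) ^ k) (A * B) ⟩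
        conj (c * (u * u) ^ k) * conj (A * B)            ≡⟨ cong₂ _*_ (conj-* c ((u * u) ^ k)) (conj-* A B) ⟩
        conj c * conj ((u * u) ^ k) * (conj A * conj B)
          ≡⟨ cong₂ (λ x y → x * y * (conj A * conj B)) (conj-ι (binom k))
                   (trans (conj-^ (u * u) k) (cong (_^ k) (conj-* u u))) ⟩
        c * (conj u * conj u) ^ k * (conj A * conj B)   ∎
      regroup : ∀ c a b d → c * a * b * (d * d) ≡ c * (a * d) * (b * d)
      regroup = Solver.solve-∀ ℤ[φ]-ring
      expand : ∀ c p q A B Ā B̄ → c * (p * A + - (q * Ā)) * (p * B + - (q * B̄))
                                 ≡ c * (p * p) * (A * B) + c * (q * q) * (Ā * B̄) + c * (p * q) * - (A * B̄ + Ā * B)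
      expand = Solver.solve-∀ ℤ[φ]-ring

    five-times-productSum : ι productSum * ι (+ 5) ≡ goldenPart + conj goldenPart + ι alternatingSum * - W
    five-times-productSum = begin
      ι productSum * ι (+ 5)                           ≡⟨ cong (_* ι (+ 5)) (ι-sumTo n term) ⟩
      ∑≤ n (ι ∘ term) * ι (+ 5)                        ≡⟨ ∑-*ʳ n (ι (+ 5)) (ι ∘ term) ⟨
      ∑[ k ≤ n ] ι (term k) * ι (+ 5)                  ≡⟨ ∑-cong n five-times-term ⟩
      ∑[ k ≤ n ] (t k + conj (t k) + a k * - W)        ≡⟨ trans (∑-+ n) (cong (_+ ∑≤ n (λ k → a k * - W)) (∑-+ n)) ⟩
      ∑≤ n t + ∑≤ n (conj ∘ t) + ∑≤ n (λ k → a k * - W)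
        ≡⟨ cong₂ (λ x y → ∑≤ n t + x + y) (sym (conj-∑ n t)) (∑-*ʳ n (- W) a) ⟩
      ∑≤ n t + conj (∑≤ n t) + ∑≤ n a * - W
        ≡⟨ cong₂ (λ x y → x + conj x + y * - W) (∑-*ʳ n (A * B) e) (sym (ι-sumTo n (λ k → binom k ℤ.* -1ℤ ℤ.^ k))) ⟩
      goldenPart + conj goldenPart + ι alternatingSum * - W ∎
      where
      term : ℕ → ℤ
      term k = binom k ℤ.* fib (+ (3 ℕ.* k) ℤ.+ r) ℤ.* fib (+ (3 ℕ.* k) ℤ.+ s)
      e t a : ℕ → ℤ[φ]
      e k = fromℕ ((2 ℕ.* n) C (2 ℕ.* k)) * (u * u) ^ k
      t k = e k * (A * B)
      a k = ι (binom k ℤ.* -1ℤ ℤ.^ k)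

    3n+r+s : ℤ
    3n+r+s = + (3 ℕ.* n) ℤ.+ r ℤ.+ s

    module _ (odd : n ℕ.% 2 ≡ 1) where
      K : ℤ
      K = + (4 ℕ.^ n) ℤ.* fib (+ n)

      twice-goldenPart : (1# + 1#) * goldenPart ≡ ι K * √5 * φ^ 3n+r+s
      twice-goldenPart = begin
        (1# + 1#) * (evenBinomial n (u * u) * (A * B))
          ≡⟨ *-assoc (1# + 1#) (evenBinomial n (u * u)) (A * B) ⟨
        (1# + 1#) * evenBinomial n (u * u) * (A * B)
          ≡⟨ cong (_* (A * B)) (twice-evenBinomial-u n odd) ⟩
        ι (+ (4 ℕ.^ n)) * u ^ n * (ι (fib (+ n)) * √5) * (A * B)
          ≡⟨ regroup (ι (+ (4 ℕ.^ n))) (ι (fib (+ n))) (u ^ n) √5 A B ⟩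
        ι (+ (4 ℕ.^ n)) * ι (fib (+ n)) * √5 * (u ^ n * A * B)
          ≡⟨ cong₂ (λ x y → x * √5 * y) (ι-* (+ (4 ℕ.^ n)) (fib (+ n)))
                   (trans (φ^-+ (+ (3 ℕ.* n) ℤ.+ r) s) (cong (_* B) (φ^-3k+ n r))) ⟨
        ι K * √5 * φ^ 3n+r+s ∎
        where
        regroup : ∀ c f p d A B → c * p * (f * d) * (A * B) ≡ c * f * d * (p * A * B)
        regroup = Solver.solve-∀ ℤ[φ]-ring

      ι-ten-times-productSum : ι productSum * ι (+ 5) * (1# + 1#) ≡ ι K * ι (fib 3n+r+s) * ι (+ 5)
      ι-ten-times-productSum = begin
        ι productSum * ι (+ 5) * (1# + 1#)
          ≡⟨ cong (_* (1# + 1#)) five-times-productSum ⟩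
        (T + conj T + ι alternatingSum * - W) * (1# + 1#)
          ≡⟨ cong (λ a → (T + conj T + ι a * - W) * (1# + 1#)) (AlternatingBinomialSum.alternating-evenBinomial n odd) ⟩
        (T + conj T + 0# * - W) * (1# + 1#)
          ≡⟨ cong (λ x → (T + conj T + x) * (1# + 1#)) (zeroˡ (- W)) ⟩
        (T + conj T + 0#) * (1# + 1#)
          ≡⟨ twice T (conj T) ⟩
        (1# + 1#) * T + (1# + 1#) * conj T
          ≡⟨ cong (λ x → (1# + 1#) * T + x) (conj-* (1# + 1#) T) ⟨
        (1# + 1#) * T + conj ((1# + 1#) * T)
          ≡⟨ cong (λ x → x + conj x) twice-goldenPart ⟩
        ι K * √5 * Φ + conj (ι K * √5 * Φ)
          ≡⟨ cong (λ x → ι K * √5 * Φ + x) conj-term ⟩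
        ι K * √5 * Φ + ι K * - √5 * conj Φ
          ≡⟨ factor (ι K) √5 Φ (conj Φ) ⟩
        ι K * √5 * (Φ - conj Φ)
          ≡⟨ cong (ι K * √5 *_) (fib-√5 3n+r+s) ⟨
        ι K * √5 * (ι (fib 3n+r+s) * √5)
          ≡⟨ regroup (ι K) (ι (fib 3n+r+s)) √5 ⟩
        ι K * ι (fib 3n+r+s) * (√5 * √5)
          ≡⟨ cong (ι K * ι (fib 3n+r+s) *_) √5*√5 ⟩
        ι K * ι (fib 3n+r+s) * ι (+ 5) ∎
        where
        T = goldenPart
        Φ = φ^ 3n+r+s
        conj-term : conj (ι K * √5 * Φ) ≡ ι K * - √5 * conj Φ
        conj-term = begin
          conj (ι K * √5 * Φ)             ≡⟨ conj-* (ι K * √5) Φ ⟩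
          conj (ι K * √5) * conj Φ        ≡⟨ cong (_* conj Φ) (conj-* (ι K) √5) ⟩
          conj (ι K) * conj √5 * conj Φ   ≡⟨ cong₂ (λ x y → x * y * conj Φ) (conj-ι K) conj-√5 ⟩
          ι K * - √5 * conj Φ             ∎
        twice : ∀ x y → (x + y + 0#) * (1# + 1#) ≡ (1# + 1#) * x + (1# + 1#) * y
        twice = Solver.solve-∀ ℤ[φ]-ring
        factor : ∀ k d x y → k * d * x + k * - d * y ≡ k * d * (x + - y)
        factor = Solver.solve-∀ ℤ[φ]-ring
        regroup : ∀ k f d → k * d * (f * d) ≡ k * f * (d * d)
        regroup = Solver.solve-∀ ℤ[φ]-ring

      ten-times-productSum : productSum ℤ.* + 5 ℤ.* + 2 ≡ + (4 ℕ.^ n) ℤ.* fib (+ n) ℤ.* fib 3n+r+s ℤ.* + 5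
      ten-times-productSum = cong proj₁ (begin
        ι (productSum ℤ.* + 5 ℤ.* + 2)       ≡⟨ trans (ι-* (productSum ℤ.* + 5) (+ 2)) (cong (_* ι (+ 2)) (ι-* productSum (+ 5))) ⟩
        ι productSum * ι (+ 5) * (1# + 1#)   ≡⟨ ι-ten-times-productSum ⟩
        ι K * ι (fib 3n+r+s) * ι (+ 5)       ≡⟨ trans (ι-* (K ℤ.* fib 3n+r+s) (+ 5)) (cong (_* ι (+ 5)) (ι-* K (fib 3n+r+s))) ⟨
        ι (K ℤ.* fib 3n+r+s ℤ.* + 5)         ∎)

open import Data.Nat using (_∸_; _^_; _%_)
open import Data.Nat.Combinatorics using (_C_)
open import Data.Integer using (_+_; _*_)

4^n≡2*2^[2n∸1] : ∀ n → 1 ℕ.≤ n → 4 ^ n ≡ 2 ℕ.* 2 ^ (2 ℕ.* n ∸ 1)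
4^n≡2*2^[2n∸1] (suc n) _ = begin
  4 ^ suc n                    ≡⟨ ℕₚ.^-*-assoc 2 2 (suc n) ⟩
  2 ^ (2 ℕ.* suc n)            ≡⟨ cong (2 ^_) (ℕₚ.*-suc 2 n) ⟩
  2 ℕ.* 2 ^ suc (2 ℕ.* n)      ≡⟨ cong (λ e → 2 ℕ.* 2 ^ (e ∸ 1)) (ℕₚ.*-suc 2 n) ⟨
  2 ℕ.* 2 ^ (2 ℕ.* suc n ∸ 1)  ∎
  where open ≡-Reasoning

corollary29 : (n : ℕ) → 1 ℕ.≤ n → n % 2 ≡ 1 → (r s : ℤ) →
    sumTo n (λ k → + ((2 ℕ.* n) C (2 ℕ.* k)) * fib (+ (3 ℕ.* k) + r) * fib (+ (3 ℕ.* k) + s))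
    ≡ + (2 ^ (2 ℕ.* n ∸ 1)) * fib (+ n) * fib (+ (3 ℕ.* n) + r + s)
corollary29 n 1≤n odd r s = ℤₚ.*-cancelʳ-≡ S RHS (+ 10) (begin
  S * + 10                         ≡⟨ ℤₚ.*-assoc S (+ 5) (+ 2) ⟨
  S * + 5 * + 2                    ≡⟨ ten-times-productSum n r s odd ⟩
  + (4 ^ n) * Fₙ * F * + 5         ≡⟨ cong (λ c → c * Fₙ * F * + 5) 4ⁿ≡2*P ⟩
  + 2 * P * Fₙ * F * + 5           ≡⟨ regroup (+ 2) P Fₙ F (+ 5) ⟩
  RHS * + 10                       ∎)
  where
  open ≡-Reasoning
  open FibonacciProductSum
  S = productSum n r s
  P = + (2 ^ (2 ℕ.* n ∸ 1))
  Fₙ = fib (+ n)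
  F = fib (+ (3 ℕ.* n) + r + s)
  RHS = P * Fₙ * F
  4ⁿ≡2*P : + (4 ^ n) ≡ + 2 * P
  4ⁿ≡2*P = trans (cong +_ (4^n≡2*2^[2n∸1] n 1≤n)) (ℤₚ.pos-* 2 (2 ^ (2 ℕ.* n ∸ 1)))
  regroup : ∀ a p f g c → a * p * f * g * c ≡ p * f * g * (c * a)
  regroup = solve-∀
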